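{- Let $t \in Lie(\mathcal{PT})$ and $\alpha_1,\alpha_2 \in S(\mathcal{PA})$. Then $$\rho(t)(\alpha_1\alpha_2)=\rho(t)(\alpha_1)\,\alpha_2+\alpha_1\,\rho(t)(\alpha_2).$$
   Context: Work over a base field $k$. A planar rooted tree is a finite rooted tree (edges directed from parent to child) together with, at each vertex, a total order on its outgoing edges; $\mathcal{PT}$ is the vector space spanned by planar rooted trees. The left grafting $t_1 \rhd t_2$ of planar trees is the sum, over all vertices $v$ of $t_2$, of the planar tree obtained by adding an edge from $v$ to the root of $t_1$, placed as the leftmost outgoing edge of $v$. Let $Lie(\mathcal{PT})$ be the free Lie algebra on $\mathcal{PT}$, with bracket $[\cdot,\cdot]$, and extend $\rhd$ to $Lie(\mathcal{PT})$ by the rules $x\rhd[y,z]=[x\rhd y,z]+[y,x\rhd z]$ and $[x,y]\rhd z=x\rhd(y\rhd z)-(x\rhd y)\rhd z-y\rhd(x\rhd z)+(y\rhd x)\rhd z$. A planar aroma is a finite connected directed graph in which every vertex has exactly one incoming edge, together with a total order on the outgoing edges of each vertex (considered up to isomorphism); $\mathcal{PA}$ is the vector space they span and $S(\mathcal{PA})$ the symmetric (polynomial) algebra on $\mathcal{PA}$. For a planar tree $t$ and a monomial $\alpha=a_1\cdots a_m$ of planar aromas, $\rho(t)(\alpha)$ is the sum, over all vertices $v$ of all the $a_i$, of the monomial obtained by adding an edge from $v$ to the root of $t$ as the leftmost outgoing edge of $v$ (which turns $a_i$ into a larger planar aroma); this is extended linearly in $\alpha$, and to Lie polynomials by $\rho([t_1,t_2])(\alpha)=\rho(t_1)(\rho(t_2)(\alpha))-\rho(t_1\rhd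 t_2)(\alpha)-\rho(t_2)(\rho(t_1)(\alpha))+\rho(t_2\rhd t_1)(\alpha)$. -}

module Defs where

open import Level using (Level)
open import Algebra.Bundles using (CommutativeRing)
open import Data.Nat using (ℕ; zero; suc; _⊔_)
open import Data.List using (List; []; _∷_; _++_; map; foldr)
open import Data.List.Relation.Binary.Permutation.Propositional using (_↭_)
open import Data.List.Relation.Binary.Pointwise using (Pointwise)
open import Data.Product using (Σ; ∃; ∃-syntax; _×_; _,_)
open import Relation.Binary.PropositionalEquality using (_≡_)
open import Relation.Nullary using (¬_)

record Field (c ℓ : Level) : Set (Level.suc (c Level.⊔ ℓ)) where
  field
    commutativeRing : CommutativeRing c ℓ
  open CommutativeRing commutativeRing public
  field
    1≉0     : ¬ (1# ≈ 0#)
    inverse : ∀ x → ¬ (x ≈ 0#) → ∃[ y ] (x * y ≈ 1#)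

data PTree : Set where
  node : List PTree → PTree

modifyOne : {A : Set} → (A → List A) → List A → List (List A)
modifyOne f []       = []
modifyOne f (x ∷ xs) = map (_∷ xs) (f x) ++ map (x ∷_) (modifyOne f xs)

mutual
  graftT : PTree → PTree → List PTree
  graftT t (node cs) = node (t ∷ cs) ∷ map node (graftF t cs)

  graftF : PTree → List PTree → List (List PTree)
  graftF t []       = []
  graftF t (c ∷ cs) = map (_∷ cs) (graftT t c) ++ map (c ∷_) (graftF t cs)

-- A finite connected digraph in which every vertex has
-- exactly one incoming edge has exactly one (directed) cycle, with planar
-- trees hanging off the cycle vertices.  A cycle vertex is encoded by the
-- planar trees attached by its outgoing edges to the LEFT of its cycle
-- edge, and those to the RIGHT of it (in the planar order).  An aroma is a
-- nonempty cyclic list of cycle vertices v₀ → v₁ → … → v₀; isomorphism of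
-- planar aromas is cyclic rotation of this list.

CycVert : Set
CycVert = List PTree × List PTree

data Aroma : Set where
  aroma : CycVert → List CycVert → Aroma

verts : Aroma → List CycVert
verts (aroma v vs) = v ∷ vs

rotate1 : Aroma → Aroma
rotate1 (aroma v [])       = aroma v []
rotate1 (aroma v (w ∷ ws)) = aroma w (ws ++ v ∷ [])

rotate : ℕ → Aroma → Aroma
rotate zero    a = a
rotate (suc n) a = rotate n (rotate1 a)

_≅A_ : Aroma → Aroma → Set
a ≅A b = ∃[ n ] (rotate n a ≡ b)

-- left grafting of t onto every vertex of a cycle vertex (incl. the tree
-- vertices hanging off it); the new edge is leftmost, i.e. before the
-- cycle edge for the cycle vertex itself
graftCV : PTree → CycVert → List CycVert
graftCV t (l , r) =
  (t ∷ l , r) ∷ (map (_, r) (graftF t l) ++ map (l ,_) (graftF t r))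

graftA : PTree → Aroma → List Aroma
graftA t (aroma v vs) =
  map (λ v' → aroma v' vs) (graftCV t v)
  ++ map (aroma v) (modifyOne (graftCV t) vs)

-- monomials of S(PA): finite lists of aromas, up to permutation and
-- isomorphism of the individual aromas
Mono : Set
Mono = List Aroma

_≈M_ : Mono → Mono → Set
m ≈M m' = ∃[ m'' ] (m ↭ m'' × Pointwise _≅A_ m'' m')

module Over {c ℓ : Level} (F : Field c ℓ) where
  open Field F renaming (Carrier to K; _+_ to _+K_; _*_ to _*K_; -_ to -K_)

  infixl 6 _⊕_
  infixr 7 _⊙_
  data Lin (B : Set) : Set c where
    ⟦_⟧ : B → Lin B
    𝟘   : Lin B
    _⊕_ : Lin B → Lin B → Lin B
    _⊙_ : K → Lin B → Lin B

  sumL : {B : Set} → List (Lin B) → Lin B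
  sumL = foldr _⊕_ 𝟘

  _⊖_ : {B : Set} → Lin B → Lin B → Lin B
  x ⊖ y = x ⊕ (-K 1#) ⊙ y

  module Space {B : Set} (_~_ : B → B → Set) where
    infix 4 _≋_
    data _≋_ : Lin B → Lin B → Set (c Level.⊔ ℓ) where
      ≋-refl   : ∀ {x} → x ≋ x
      ≋-sym    : ∀ {x y} → x ≋ y → y ≋ x
      ≋-trans  : ∀ {x y z} → x ≋ y → y ≋ z → x ≋ z
      ⊕-cong   : ∀ {x x' y y'} → x ≋ x' → y ≋ y' → x ⊕ y ≋ x' ⊕ y'
      ⊙-cong   : ∀ {a b x y} → a ≈ b → x ≋ y → a ⊙ x ≋ b ⊙ y
      ⊕-assoc  : ∀ x y z → (x ⊕ y) ⊕ z ≋ x ⊕ (y ⊕ z)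
      ⊕-comm   : ∀ x y → x ⊕ y ≋ y ⊕ x
      ⊕-idˡ    : ∀ x → 𝟘 ⊕ x ≋ x
      ⊕-inv    : ∀ x → x ⊕ (-K 1#) ⊙ x ≋ 𝟘
      ⊙-one    : ∀ x → 1# ⊙ x ≋ x
      ⊙-assoc  : ∀ a b x → (a *K b) ⊙ x ≋ a ⊙ (b ⊙ x)
      ⊙-distrʳ : ∀ a b x → (a +K b) ⊙ x ≋ a ⊙ x ⊕ b ⊙ x
      ⊙-distrˡ : ∀ a x y → a ⊙ (x ⊕ y) ≋ a ⊙ x ⊕ a ⊙ y
      basis    : ∀ {b b'} → b ~ b' → ⟦ b ⟧ ≋ ⟦ b' ⟧

  SPA : Set c
  SPA = Lin Mono

  open Space _≈M_ public using (_≋_)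

  mulM : Mono → SPA → SPA
  mulM m ⟦ n ⟧   = ⟦ m ++ n ⟧
  mulM m 𝟘       = 𝟘
  mulM m (x ⊕ y) = mulM m x ⊕ mulM m y
  mulM m (a ⊙ x) = a ⊙ mulM m x

  infixl 7 _·_
  _·_ : SPA → SPA → SPA
  ⟦ m ⟧   · β = mulM m β
  𝟘       · β = 𝟘
  (x ⊕ y) · β = x · β ⊕ y · β
  (a ⊙ x) · β = a ⊙ (x · β)

  data LieE : Set c where
    gen  : PTree → LieE
    𝟘ᴸ   : LieE
    _⊕ᴸ_ : LieE → LieE → LieE
    _⊙ᴸ_ : K → LieE → LieE
    br   : LieE → LieE → LieE

  _⊖ᴸ_ : LieE → LieE → LieE
  x ⊖ᴸ y = x ⊕ᴸ ((-K 1#) ⊙ᴸ y)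

  sumᴸ : List LieE → LieE
  sumᴸ = foldr _⊕ᴸ_ 𝟘ᴸ

  depth : LieE → ℕ
  depth (gen t)  = 0
  depth 𝟘ᴸ       = 0
  depth (x ⊕ᴸ y) = depth x ⊔ depth y
  depth (a ⊙ᴸ x) = depth x
  depth (br x y) = suc (depth x ⊔ depth y)

  genGr : PTree → LieE → LieE
  genGr s (gen t)  = sumᴸ (map gen (graftT s t))
  genGr s 𝟘ᴸ       = 𝟘ᴸ
  genGr s (x ⊕ᴸ y) = genGr s x ⊕ᴸ genGr s y
  genGr s (a ⊙ᴸ x) = a ⊙ᴸ genGr s x
  genGr s (br y z) = br (genGr s y) z ⊕ᴸ br y (genGr s z)

  -- x ▷ z, by recursion on (fuel, x); the fuel bounds the bracket depth of
  -- x (depth (x ▷ y) ≤ depth y, so fuel = depth x always suffices and the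
  -- "zero fuel" clause is never reached from _▷_ below)
  grF : ℕ → LieE → LieE → LieE
  grF n (gen s)  z = genGr s z
  grF n 𝟘ᴸ       z = 𝟘ᴸ
  grF n (x ⊕ᴸ y) z = grF n x z ⊕ᴸ grF n y z
  grF n (a ⊙ᴸ x) z = a ⊙ᴸ grF n x z
  grF zero    (br x y) z = 𝟘ᴸ
  grF (suc n) (br x y) z =
    ((grF n x (grF n y z) ⊖ᴸ grF n (grF n x y) z)
      ⊖ᴸ grF n y (grF n x z)) ⊕ᴸ grF n (grF n y x) z

  infixr 8 _▷_
  _▷_ : LieE → LieE → LieE
  x ▷ z = grF (depth x) x z

  ρgen : PTree → SPA → SPA
  ρgen t ⟦ m ⟧   = sumL (map ⟦_⟧ (modifyOne (graftA t) m))
  ρgen t 𝟘       = 𝟘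
  ρgen t (x ⊕ y) = ρgen t x ⊕ ρgen t y
  ρgen t (a ⊙ x) = a ⊙ ρgen t x

  ρF : ℕ → LieE → SPA → SPA
  ρF n (gen t)  α = ρgen t α
  ρF n 𝟘ᴸ       α = 𝟘
  ρF n (x ⊕ᴸ y) α = ρF n x α ⊕ ρF n y α
  ρF n (a ⊙ᴸ x) α = a ⊙ ρF n x α
  ρF zero    (br x y) α = 𝟘
  ρF (suc n) (br x y) α =
    ((ρF n x (ρF n y α) ⊖ ρF n (x ▷ y) α) ⊖ ρF n y (ρF n x α))
      ⊕ ρF n (y ▷ x) α

  ρ : LieE → SPA → SPA
  ρ t = ρF (depth t) t

-- ρ(t) of a planar tree t grafts t onto one vertex of one aroma of a monomial, so on a
-- product it grafts either into the first factor or into the second: on monomials the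
-- Leibniz rule is the list identity modifyOne-++.  Linear combinations of derivations are
-- derivations, and so is the commutator of two linear derivations; since ρ([x,y]) is the
-- commutator of ρ(x) and ρ(y) corrected by ρ(x ▷ y) and ρ(y ▷ x), induction over Lie
-- polynomials finishes the proof.

module Submission where

open import Level using (Level; _⊔_)
open import Algebra.Bundles using (AbelianGroup)
import Algebra.Properties.AbelianGroup as AbelianGroupProperties
import Algebra.Properties.CommutativeSemigroup as CommutativeSemigroupProperties
import Algebra.Properties.Group as GroupProperties
open import Data.List using (List; []; _∷_; _++_; map)
open import Data.List.Properties using (map-id; map-++; map-∘; ++-assoc)
open import Data.Nat using (zero; suc)
open import Data.Product using (_,_)
open import Relation.Binary.PropositionalEquality as ≡ using (_≡_)
import Relation.Binary.Reasoning.Setoid as SetoidReasoning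
open import Defs

modifyOne-++ : {A : Set} (f : A → List A) (xs ys : List A) →
  modifyOne f (xs ++ ys) ≡ map (_++ ys) (modifyOne f xs) ++ map (xs ++_) (modifyOne f ys)
modifyOne-++ f []       ys = ≡.sym (map-id (modifyOne f ys))
modifyOne-++ {A} f (x ∷ xs) ys = begin
  map (_∷ (xs ++ ys)) (f x) ++ map (x ∷_) (modifyOne f (xs ++ ys))
    ≡⟨ ≡.cong₂ _++_ (map-∘ (f x)) (≡.cong (map (x ∷_)) (modifyOne-++ f xs ys)) ⟩
  map (_++ ys) here ++ map (x ∷_) (map (_++ ys) there ++ map (xs ++_) right)
    ≡⟨ ≡.cong (map (_++ ys) here ++_) (map-++ (x ∷_) (map (_++ ys) there) _) ⟩
  map (_++ ys) here ++ (map (x ∷_) (map (_++ ys) there) ++ map (x ∷_) (map (xs ++_) right))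
    ≡⟨ ≡.cong₂ (λ u v → map (_++ ys) here ++ (u ++ v))
               (≡.trans (≡.sym (map-∘ there)) (map-∘ there)) (≡.sym (map-∘ right)) ⟩
  map (_++ ys) here ++ (map (_++ ys) (map (x ∷_) there) ++ map ((x ∷ xs) ++_) right)
    ≡⟨ ≡.sym (++-assoc (map (_++ ys) here) _ _) ⟩
  (map (_++ ys) here ++ map (_++ ys) (map (x ∷_) there)) ++ map ((x ∷ xs) ++_) right
    ≡⟨ ≡.cong (_++ map ((x ∷ xs) ++_) right) (≡.sym (map-++ (_++ ys) here _)) ⟩
  map (_++ ys) (here ++ map (x ∷_) there) ++ map ((x ∷ xs) ++_) right
    ∎
  where
  open ≡.≡-Reasoning
  here there right : List (List A)
  here  = map (_∷ xs) (f x)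
  there = modifyOne f xs
  right = modifyOne f ys

module _ {a ℓ} (G : AbelianGroup a ℓ) where
  open AbelianGroup G
  open AbelianGroupProperties G using (⁻¹-∙-comm)
  open CommutativeSemigroupProperties commutativeSemigroup using (interchange)
  open SetoidReasoning setoid

  cross-terms-cancel : ∀ x y z w x′ w′ →
    (x ∙ y) ∙ (z ∙ w) - (x′ ∙ z) ∙ (y ∙ w′) ≈ (x - x′) ∙ (w - w′)
  cross-terms-cancel x y z w x′ w′ = begin
    (x ∙ y) ∙ (z ∙ w) - (x′ ∙ z) ∙ (y ∙ w′)
      ≈⟨ -‿cong (trans (∙-congˡ (comm z w)) (interchange x y w z))
                (trans (∙-congˡ (comm y w′)) (trans (interchange x′ z w′ y) (∙-congˡ (comm z y)))) ⟩
    (x ∙ w) ∙ (y ∙ z) - (x′ ∙ w′) ∙ (y ∙ z)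
      ≈⟨ ∙-congˡ (sym (⁻¹-∙-comm (x′ ∙ w′) (y ∙ z))) ⟩
    (x ∙ w) ∙ (y ∙ z) ∙ ((x′ ∙ w′) ⁻¹ ∙ (y ∙ z) ⁻¹)
      ≈⟨ interchange (x ∙ w) (y ∙ z) _ _ ⟩
    ((x ∙ w) - (x′ ∙ w′)) ∙ ((y ∙ z) - (y ∙ z))
      ≈⟨ ∙-cong (∙-congˡ (sym (⁻¹-∙-comm x′ w′))) (inverseʳ (y ∙ z)) ⟩
    (x ∙ w) ∙ (x′ ⁻¹ ∙ w′ ⁻¹) ∙ ε
      ≈⟨ trans (identityʳ _) (interchange x w _ _) ⟩
    (x - x′) ∙ (w - w′)
      ∎
    where
    -‿cong : ∀ {u u′ v v′} → u ≈ u′ → v ≈ v′ → u - v ≈ u′ - v′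
    -‿cong p q = ∙-cong p (⁻¹-cong q)

module Leibniz {c ℓ : Level} (F : Field c ℓ) where
  open Over F
  open Field F using (1#; *-comm)
    renaming (Carrier to K; _+_ to _+K_; _*_ to _*K_; -_ to -K_; refl to reflK)
  -- The free space on monomial lists, which maps onto S(PA): the Leibniz rule already holds
  -- there, so we never need that ρ respects permutation and rotation of aromas.
  open Space {Mono} _≡_ renaming (_≋_ to _∼_)

  -1# : K
  -1# = -K 1#

  ∼⇒≋ : ∀ {x y} → x ∼ y → x ≋ y
  ∼⇒≋ ≋-refl           = Space.≋-refl
  ∼⇒≋ (≋-sym p)        = Space.≋-sym (∼⇒≋ p)
  ∼⇒≋ (≋-trans p q)    = Space.≋-trans (∼⇒≋ p) (∼⇒≋ q)
  ∼⇒≋ (⊕-cong p q)     = Space.⊕-cong (∼⇒≋ p) (∼⇒≋ q)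
  ∼⇒≋ (⊙-cong e p)     = Space.⊙-cong e (∼⇒≋ p)
  ∼⇒≋ (⊕-assoc x y z)  = Space.⊕-assoc x y z
  ∼⇒≋ (⊕-comm x y)     = Space.⊕-comm x y
  ∼⇒≋ (⊕-idˡ x)        = Space.⊕-idˡ x
  ∼⇒≋ (⊕-inv x)        = Space.⊕-inv x
  ∼⇒≋ (⊙-one x)        = Space.⊙-one x
  ∼⇒≋ (⊙-assoc a b x)  = Space.⊙-assoc a b x
  ∼⇒≋ (⊙-distrʳ a b x) = Space.⊙-distrʳ a b x
  ∼⇒≋ (⊙-distrˡ a x y) = Space.⊙-distrˡ a x y
  ∼⇒≋ (basis ≡.refl)   = Space.≋-refl

  ⊕-abelianGroup : AbelianGroup c (c ⊔ ℓ)
  ⊕-abelianGroup = record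
    { Carrier        = SPA
    ; _≈_            = _∼_
    ; _∙_            = _⊕_
    ; ε              = 𝟘
    ; _⁻¹            = -1# ⊙_
    ; isAbelianGroup = record
      { isGroup = record
        { isMonoid = record
          { isSemigroup = record
            { isMagma = record
              { isEquivalence = record { refl = ≋-refl ; sym = ≋-sym ; trans = ≋-trans }
              ; ∙-cong        = ⊕-cong
              }
            ; assoc = ⊕-assoc
            }
          ; identity = ⊕-idˡ , λ x → ≋-trans (⊕-comm x 𝟘) (⊕-idˡ x)
          }
        ; inverse = (λ x → ≋-trans (⊕-comm (-1# ⊙ x) x) (⊕-inv x)) , ⊕-inv
        ; ⁻¹-cong = ⊙-cong reflK
        }
      ; comm = ⊕-comm
      }
    }

  open AbelianGroup ⊕-abelianGroup using (setoid; ∙-congˡ; ∙-congʳ; group; commutativeSemigroup)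
  open GroupProperties group using (identityˡ-unique)
  open CommutativeSemigroupProperties commutativeSemigroup using (interchange; xy∙z≈xz∙y)
  open SetoidReasoning setoid

  ⊙-zeroʳ : ∀ a → a ⊙ 𝟘 ∼ 𝟘
  ⊙-zeroʳ a = identityˡ-unique (a ⊙ 𝟘) (a ⊙ 𝟘) (begin
    a ⊙ 𝟘 ⊕ a ⊙ 𝟘 ≈⟨ ⊙-distrˡ a 𝟘 𝟘 ⟨
    a ⊙ (𝟘 ⊕ 𝟘)   ≈⟨ ⊙-cong reflK (⊕-idˡ 𝟘) ⟩
    a ⊙ 𝟘         ∎)

  ⊙-comm : ∀ a b x → a ⊙ (b ⊙ x) ∼ b ⊙ (a ⊙ x)
  ⊙-comm a b x = begin
    a ⊙ (b ⊙ x)  ≈⟨ ⊙-assoc a b x ⟨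
    (a *K b) ⊙ x ≈⟨ ⊙-cong (*-comm a b) ≋-refl ⟩
    (b *K a) ⊙ x ≈⟨ ⊙-assoc b a x ⟩
    b ⊙ (a ⊙ x)  ∎

  record IsLinear (D : SPA → SPA) : Set (c ⊔ ℓ) where
    field
      ⊕-homo : ∀ x y → D (x ⊕ y) ∼ D x ⊕ D y
      ⊙-homo : ∀ a x → D (a ⊙ x) ∼ a ⊙ D x
      𝟘-homo : D 𝟘 ∼ 𝟘

    cong : ∀ {x y} → x ∼ y → D x ∼ D y
    cong ≋-refl        = ≋-refl
    cong (≋-sym p)     = ≋-sym (cong p)
    cong (≋-trans p q) = ≋-trans (cong p) (cong q)
    cong (⊕-cong {x} {x′} {y} {y′} p q) = begin
      D (x ⊕ y)     ≈⟨ ⊕-homo x y ⟩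
      D x ⊕ D y     ≈⟨ ⊕-cong (cong p) (cong q) ⟩
      D x′ ⊕ D y′   ≈⟨ ⊕-homo x′ y′ ⟨
      D (x′ ⊕ y′)   ∎
    cong (⊙-cong {a} {b} {x} {y} e p) = begin
      D (a ⊙ x)     ≈⟨ ⊙-homo a x ⟩
      a ⊙ D x       ≈⟨ ⊙-cong e (cong p) ⟩
      b ⊙ D y       ≈⟨ ⊙-homo b y ⟨
      D (b ⊙ y)     ∎
    cong (⊕-assoc x y z) = begin
      D ((x ⊕ y) ⊕ z)       ≈⟨ ≋-trans (⊕-homo (x ⊕ y) z) (∙-congʳ (⊕-homo x y)) ⟩
      (D x ⊕ D y) ⊕ D z     ≈⟨ ⊕-assoc (D x) (D y) (D z) ⟩
      D x ⊕ (D y ⊕ D z)     ≈⟨ ≋-trans (⊕-homo x (y ⊕ z)) (∙-congˡ (⊕-homo y z)) ⟨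
      D (x ⊕ (y ⊕ z))       ∎
    cong (⊕-comm x y) = begin
      D (x ⊕ y)     ≈⟨ ⊕-homo x y ⟩
      D x ⊕ D y     ≈⟨ ⊕-comm (D x) (D y) ⟩
      D y ⊕ D x     ≈⟨ ⊕-homo y x ⟨
      D (y ⊕ x)     ∎
    cong (⊕-idˡ x) = begin
      D (𝟘 ⊕ x)     ≈⟨ ⊕-homo 𝟘 x ⟩
      D 𝟘 ⊕ D x     ≈⟨ ∙-congʳ 𝟘-homo ⟩
      𝟘 ⊕ D x       ≈⟨ ⊕-idˡ (D x) ⟩
      D x           ∎
    cong (⊕-inv x) = begin
      D (x ⊕ -1# ⊙ x)   ≈⟨ ⊕-homo x (-1# ⊙ x) ⟩
      D x ⊕ D (-1# ⊙ x) ≈⟨ ∙-congˡ (⊙-homo -1# x) ⟩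
      D x ⊕ -1# ⊙ D x   ≈⟨ ⊕-inv (D x) ⟩
      𝟘                 ≈⟨ 𝟘-homo ⟨
      D 𝟘               ∎
    cong (⊙-one x) = ≋-trans (⊙-homo 1# x) (⊙-one (D x))
    cong (⊙-assoc a b x) = begin
      D ((a *K b) ⊙ x)  ≈⟨ ⊙-homo (a *K b) x ⟩
      (a *K b) ⊙ D x    ≈⟨ ⊙-assoc a b (D x) ⟩
      a ⊙ (b ⊙ D x)     ≈⟨ ≋-trans (⊙-homo a (b ⊙ x)) (⊙-cong reflK (⊙-homo b x)) ⟨
      D (a ⊙ (b ⊙ x))   ∎
    cong (⊙-distrʳ a b x) = begin
      D ((a +K b) ⊙ x)        ≈⟨ ⊙-homo (a +K b) x ⟩
      (a +K b) ⊙ D x          ≈⟨ ⊙-distrʳ a b (D x) ⟩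
      a ⊙ D x ⊕ b ⊙ D x       ≈⟨ ≋-trans (⊕-homo (a ⊙ x) (b ⊙ x)) (⊕-cong (⊙-homo a x) (⊙-homo b x)) ⟨
      D (a ⊙ x ⊕ b ⊙ x)       ∎
    cong (⊙-distrˡ a x y) = begin
      D (a ⊙ (x ⊕ y))         ≈⟨ ≋-trans (⊙-homo a (x ⊕ y)) (⊙-cong reflK (⊕-homo x y)) ⟩
      a ⊙ (D x ⊕ D y)         ≈⟨ ⊙-distrˡ a (D x) (D y) ⟩
      a ⊙ D x ⊕ a ⊙ D y       ≈⟨ ≋-trans (⊕-homo (a ⊙ x) (a ⊙ y)) (⊕-cong (⊙-homo a x) (⊙-homo a y)) ⟨
      D (a ⊙ x ⊕ a ⊙ y)       ∎
    cong (basis ≡.refl) = ≋-refl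

  open IsLinear

  ·-linearˡ : ∀ β → IsLinear (_· β)
  ·-linearˡ β = record
    { ⊕-homo = λ _ _ → ≋-refl ; ⊙-homo = λ _ _ → ≋-refl ; 𝟘-homo = ≋-refl }

  ·-linearʳ : ∀ α → IsLinear (α ·_)
  ·-linearʳ α = record { ⊕-homo = ·-distribˡ α ; ⊙-homo = ·-⊙-comm α ; 𝟘-homo = ·-zeroʳ α }
    where
    ·-distribˡ : ∀ α x y → α · (x ⊕ y) ∼ α · x ⊕ α · y
    ·-distribˡ ⟦ m ⟧   x y = ≋-refl
    ·-distribˡ 𝟘       x y = ≋-sym (⊕-idˡ 𝟘)
    ·-distribˡ (u ⊕ v) x y = ≋-trans (⊕-cong (·-distribˡ u x y) (·-distribˡ v x y)) (interchange _ _ _ _)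
    ·-distribˡ (a ⊙ u) x y = ≋-trans (⊙-cong reflK (·-distribˡ u x y)) (⊙-distrˡ a _ _)

    ·-⊙-comm : ∀ α a x → α · (a ⊙ x) ∼ a ⊙ (α · x)
    ·-⊙-comm ⟦ m ⟧   a x = ≋-refl
    ·-⊙-comm 𝟘       a x = ≋-sym (⊙-zeroʳ a)
    ·-⊙-comm (u ⊕ v) a x = ≋-trans (⊕-cong (·-⊙-comm u a x) (·-⊙-comm v a x)) (≋-sym (⊙-distrˡ a _ _))
    ·-⊙-comm (b ⊙ u) a x = ≋-trans (⊙-cong reflK (·-⊙-comm u a x)) (⊙-comm b a _)

    ·-zeroʳ : ∀ α → α · 𝟘 ∼ 𝟘
    ·-zeroʳ ⟦ m ⟧   = ≋-refl
    ·-zeroʳ 𝟘       = ≋-refl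
    ·-zeroʳ (u ⊕ v) = ≋-trans (⊕-cong (·-zeroʳ u) (·-zeroʳ v)) (⊕-idˡ 𝟘)
    ·-zeroʳ (a ⊙ u) = ≋-trans (⊙-cong reflK (·-zeroʳ u)) (⊙-zeroʳ a)

  zero-linear : IsLinear (λ _ → 𝟘)
  zero-linear = record
    { ⊕-homo = λ _ _ → ≋-sym (⊕-idˡ 𝟘) ; ⊙-homo = λ a _ → ≋-sym (⊙-zeroʳ a) ; 𝟘-homo = ≋-refl }

  ∘-linear : ∀ {D₁ D₂} → IsLinear D₁ → IsLinear D₂ → IsLinear (λ α → D₁ (D₂ α))
  ∘-linear {D₁} {D₂} L₁ L₂ = record
    { ⊕-homo = λ x y → ≋-trans (cong L₁ (⊕-homo L₂ x y)) (⊕-homo L₁ (D₂ x) (D₂ y))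
    ; ⊙-homo = λ a x → ≋-trans (cong L₁ (⊙-homo L₂ a x)) (⊙-homo L₁ a (D₂ x))
    ; 𝟘-homo = ≋-trans (cong L₁ (𝟘-homo L₂)) (𝟘-homo L₁)
    }

  ⊕-linear : ∀ {D₁ D₂} → IsLinear D₁ → IsLinear D₂ → IsLinear (λ α → D₁ α ⊕ D₂ α)
  ⊕-linear L₁ L₂ = record
    { ⊕-homo = λ x y → ≋-trans (⊕-cong (⊕-homo L₁ x y) (⊕-homo L₂ x y)) (interchange _ _ _ _)
    ; ⊙-homo = λ a x → ≋-trans (⊕-cong (⊙-homo L₁ a x) (⊙-homo L₂ a x)) (≋-sym (⊙-distrˡ a _ _))
    ; 𝟘-homo = ≋-trans (⊕-cong (𝟘-homo L₁) (𝟘-homo L₂)) (⊕-idˡ 𝟘)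
    }

  ⊙-linear : ∀ {D} a → IsLinear D → IsLinear (λ α → a ⊙ D α)
  ⊙-linear a L = record
    { ⊕-homo = λ x y → ≋-trans (⊙-cong reflK (⊕-homo L x y)) (⊙-distrˡ a _ _)
    ; ⊙-homo = λ b x → ≋-trans (⊙-cong reflK (⊙-homo L b x)) (⊙-comm a b _)
    ; 𝟘-homo = ≋-trans (⊙-cong reflK (𝟘-homo L)) (⊙-zeroʳ a)
    }

  IsDerivation : (SPA → SPA) → Set (c ⊔ ℓ)
  IsDerivation D = ∀ α β → D (α · β) ∼ D α · β ⊕ α · D β

  zero-derivation : IsDerivation (λ _ → 𝟘)
  zero-derivation α β = ≋-sym (≋-trans (∙-congˡ (𝟘-homo (·-linearʳ α))) (⊕-idˡ 𝟘))

  ⊕-derivation : ∀ {D₁ D₂} → IsDerivation D₁ → IsDerivation D₂ → IsDerivation (λ α → D₁ α ⊕ D₂ α)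
  ⊕-derivation {D₁} {D₂} d₁ d₂ α β = begin
    D₁ (α · β) ⊕ D₂ (α · β)                             ≈⟨ ⊕-cong (d₁ α β) (d₂ α β) ⟩
    (D₁ α · β ⊕ α · D₁ β) ⊕ (D₂ α · β ⊕ α · D₂ β)       ≈⟨ interchange _ _ _ _ ⟩
    (D₁ α · β ⊕ D₂ α · β) ⊕ (α · D₁ β ⊕ α · D₂ β)       ≈⟨ ∙-congˡ (⊕-homo (·-linearʳ α) (D₁ β) (D₂ β)) ⟨
    (D₁ α ⊕ D₂ α) · β ⊕ α · (D₁ β ⊕ D₂ β)               ∎

  ⊙-derivation : ∀ {D} a → IsDerivation D → IsDerivation (λ α → a ⊙ D α)
  ⊙-derivation {D} a d α β = begin
    a ⊙ D (α · β)                   ≈⟨ ⊙-cong reflK (d α β) ⟩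
    a ⊙ (D α · β ⊕ α · D β)         ≈⟨ ⊙-distrˡ a _ _ ⟩
    a ⊙ (D α · β) ⊕ a ⊙ (α · D β)   ≈⟨ ∙-congˡ (⊙-homo (·-linearʳ α) a (D β)) ⟨
    (a ⊙ D α) · β ⊕ α · (a ⊙ D β)   ∎

  derivation-resp : ∀ {D D′} → (∀ α → D α ∼ D′ α) → IsDerivation D′ → IsDerivation D
  derivation-resp {D} {D′} D∼D′ d α β = begin
    D (α · β)             ≈⟨ D∼D′ (α · β) ⟩
    D′ (α · β)            ≈⟨ d α β ⟩
    D′ α · β ⊕ α · D′ β   ≈⟨ ⊕-cong (cong (·-linearˡ β) (D∼D′ α)) (cong (·-linearʳ α) (D∼D′ β)) ⟨
    D α · β ⊕ α · D β     ∎

  commutator-derivation : ∀ {D₁ D₂} → IsLinear D₁ → IsLinear D₂ →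
    IsDerivation D₁ → IsDerivation D₂ → IsDerivation (λ α → D₁ (D₂ α) ⊕ -1# ⊙ D₂ (D₁ α))
  commutator-derivation {D₁} {D₂} L₁ L₂ d₁ d₂ α β = begin
    D₁ (D₂ (α · β)) ⊕ -1# ⊙ D₂ (D₁ (α · β))
      ≈⟨ ⊕-cong (second-order L₁ L₂ d₁ d₂) (⊙-cong reflK (second-order L₂ L₁ d₂ d₁)) ⟩
    (D₁ (D₂ α) · β ⊕ D₂ α · D₁ β) ⊕ (D₁ α · D₂ β ⊕ α · D₁ (D₂ β))
      ⊕ -1# ⊙ ((D₂ (D₁ α) · β ⊕ D₁ α · D₂ β) ⊕ (D₂ α · D₁ β ⊕ α · D₂ (D₁ β)))
      ≈⟨ cross-terms-cancel ⊕-abelianGroup _ _ _ _ _ _ ⟩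
    (D₁ (D₂ α) · β ⊕ -1# ⊙ (D₂ (D₁ α) · β)) ⊕ (α · D₁ (D₂ β) ⊕ -1# ⊙ (α · D₂ (D₁ β)))
      ≈⟨ ∙-congˡ (≋-trans (⊕-homo (·-linearʳ α) _ _) (∙-congˡ (⊙-homo (·-linearʳ α) -1# _))) ⟨
    (D₁ (D₂ α) ⊕ -1# ⊙ D₂ (D₁ α)) · β ⊕ α · (D₁ (D₂ β) ⊕ -1# ⊙ D₂ (D₁ β))
      ∎
    where
    second-order : ∀ {E₁ E₂} → IsLinear E₁ → IsLinear E₂ → IsDerivation E₁ → IsDerivation E₂ →
      E₁ (E₂ (α · β)) ∼ (E₁ (E₂ α) · β ⊕ E₂ α · E₁ β) ⊕ (E₁ α · E₂ β ⊕ α · E₁ (E₂ β))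
    second-order {E₁} {E₂} M₁ M₂ e₁ e₂ = begin
      E₁ (E₂ (α · β))               ≈⟨ cong M₁ (e₂ α β) ⟩
      E₁ (E₂ α · β ⊕ α · E₂ β)      ≈⟨ ⊕-homo M₁ _ _ ⟩
      E₁ (E₂ α · β) ⊕ E₁ (α · E₂ β) ≈⟨ ⊕-cong (e₁ (E₂ α) β) (e₁ α (E₂ β)) ⟩
      _                             ∎

  derivation-fromMonomials : ∀ {D} → IsLinear D →
    (∀ m n → D ⟦ m ++ n ⟧ ∼ D ⟦ m ⟧ · ⟦ n ⟧ ⊕ ⟦ m ⟧ · D ⟦ n ⟧) → IsDerivation D
  derivation-fromMonomials {D} L leibniz = general
    where
    monomialˡ : ∀ m β → D (⟦ m ⟧ · β) ∼ D ⟦ m ⟧ · β ⊕ ⟦ m ⟧ · D β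
    monomialˡ m ⟦ n ⟧   = leibniz m n
    monomialˡ m 𝟘       = begin
      D 𝟘                               ≈⟨ 𝟘-homo L ⟩
      𝟘                                 ≈⟨ ⊕-idˡ 𝟘 ⟨
      𝟘 ⊕ 𝟘                             ≈⟨ ⊕-cong (𝟘-homo (·-linearʳ (D ⟦ m ⟧)))
                                                  (cong (·-linearʳ ⟦ m ⟧) (𝟘-homo L)) ⟨
      D ⟦ m ⟧ · 𝟘 ⊕ ⟦ m ⟧ · D 𝟘         ∎
    monomialˡ m (u ⊕ v) = begin
      D (⟦ m ⟧ · u ⊕ ⟦ m ⟧ · v)
        ≈⟨ ≋-trans (⊕-homo L _ _) (⊕-cong (monomialˡ m u) (monomialˡ m v)) ⟩
      (D ⟦ m ⟧ · u ⊕ ⟦ m ⟧ · D u) ⊕ (D ⟦ m ⟧ · v ⊕ ⟦ m ⟧ · D v)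
        ≈⟨ interchange _ _ _ _ ⟩
      (D ⟦ m ⟧ · u ⊕ D ⟦ m ⟧ · v) ⊕ (⟦ m ⟧ · D u ⊕ ⟦ m ⟧ · D v)
        ≈⟨ ⊕-cong (⊕-homo (·-linearʳ (D ⟦ m ⟧)) u v) (cong (·-linearʳ ⟦ m ⟧) (⊕-homo L u v)) ⟨
      D ⟦ m ⟧ · (u ⊕ v) ⊕ ⟦ m ⟧ · D (u ⊕ v)
        ∎
    monomialˡ m (a ⊙ u) = begin
      D (a ⊙ (⟦ m ⟧ · u))
        ≈⟨ ≋-trans (⊙-homo L _ _) (⊙-cong reflK (monomialˡ m u)) ⟩
      a ⊙ (D ⟦ m ⟧ · u ⊕ ⟦ m ⟧ · D u)
        ≈⟨ ⊙-distrˡ a _ _ ⟩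
      a ⊙ (D ⟦ m ⟧ · u) ⊕ a ⊙ (⟦ m ⟧ · D u)
        ≈⟨ ⊕-cong (⊙-homo (·-linearʳ (D ⟦ m ⟧)) a u) (cong (·-linearʳ ⟦ m ⟧) (⊙-homo L a u)) ⟨
      D ⟦ m ⟧ · (a ⊙ u) ⊕ ⟦ m ⟧ · D (a ⊙ u)
        ∎

    general : IsDerivation D
    general ⟦ m ⟧   β = monomialˡ m β
    general 𝟘       β = begin
      D 𝟘                 ≈⟨ 𝟘-homo L ⟩
      𝟘                   ≈⟨ ⊕-idˡ 𝟘 ⟨
      𝟘 ⊕ 𝟘               ≈⟨ ∙-congʳ (cong (·-linearˡ β) (𝟘-homo L)) ⟨
      D 𝟘 · β ⊕ 𝟘 · D β   ∎
    general (x ⊕ y) β = begin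
      D (x · β ⊕ y · β)                           ≈⟨ ≋-trans (⊕-homo L _ _) (⊕-cong (general x β) (general y β)) ⟩
      (D x · β ⊕ x · D β) ⊕ (D y · β ⊕ y · D β)   ≈⟨ interchange _ _ _ _ ⟩
      (D x · β ⊕ D y · β) ⊕ (x · D β ⊕ y · D β)   ≈⟨ ∙-congʳ (cong (·-linearˡ β) (⊕-homo L x y)) ⟨
      D (x ⊕ y) · β ⊕ (x ⊕ y) · D β               ∎
    general (a ⊙ x) β = begin
      D (a ⊙ (x · β))                     ≈⟨ ≋-trans (⊙-homo L _ _) (⊙-cong reflK (general x β)) ⟩
      a ⊙ (D x · β ⊕ x · D β)             ≈⟨ ⊙-distrˡ a _ _ ⟩
      a ⊙ (D x · β) ⊕ a ⊙ (x · D β)       ≈⟨ ∙-congʳ (cong (·-linearˡ β) (⊙-homo L a x)) ⟨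
      D (a ⊙ x) · β ⊕ (a ⊙ x) · D β       ∎

  Σ⟦_⟧ : List Mono → SPA
  Σ⟦ ms ⟧ = sumL (map ⟦_⟧ ms)

  Σ⟦⟧-++ : ∀ ms ns → Σ⟦ ms ++ ns ⟧ ∼ Σ⟦ ms ⟧ ⊕ Σ⟦ ns ⟧
  Σ⟦⟧-++ []       ns = ≋-sym (⊕-idˡ _)
  Σ⟦⟧-++ (m ∷ ms) ns = ≋-trans (∙-congˡ (Σ⟦⟧-++ ms ns)) (≋-sym (⊕-assoc _ _ _))

  Σ⟦⟧-map-++ʳ : ∀ n ms → Σ⟦ map (_++ n) ms ⟧ ≡ Σ⟦ ms ⟧ · ⟦ n ⟧
  Σ⟦⟧-map-++ʳ n []       = ≡.refl
  Σ⟦⟧-map-++ʳ n (m ∷ ms) = ≡.cong (⟦ m ++ n ⟧ ⊕_) (Σ⟦⟧-map-++ʳ n ms)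

  Σ⟦⟧-map-++ˡ : ∀ m ns → Σ⟦ map (m ++_) ns ⟧ ≡ ⟦ m ⟧ · Σ⟦ ns ⟧
  Σ⟦⟧-map-++ˡ m []       = ≡.refl
  Σ⟦⟧-map-++ˡ m (n ∷ ns) = ≡.cong (⟦ m ++ n ⟧ ⊕_) (Σ⟦⟧-map-++ˡ m ns)

  ρgen-linear : ∀ t → IsLinear (ρgen t)
  ρgen-linear t = record
    { ⊕-homo = λ _ _ → ≋-refl ; ⊙-homo = λ _ _ → ≋-refl ; 𝟘-homo = ≋-refl }

  ρgen-derivation : ∀ t → IsDerivation (ρgen t)
  ρgen-derivation t = derivation-fromMonomials (ρgen-linear t) λ m n → begin
    Σ⟦ graftOne (m ++ n) ⟧
      ≡⟨ ≡.cong Σ⟦_⟧ (modifyOne-++ (graftA t) m n) ⟩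
    Σ⟦ map (_++ n) (graftOne m) ++ map (m ++_) (graftOne n) ⟧
      ≈⟨ Σ⟦⟧-++ (map (_++ n) (graftOne m)) _ ⟩
    Σ⟦ map (_++ n) (graftOne m) ⟧ ⊕ Σ⟦ map (m ++_) (graftOne n) ⟧
      ≡⟨ ≡.cong₂ _⊕_ (Σ⟦⟧-map-++ʳ n (graftOne m)) (Σ⟦⟧-map-++ˡ m (graftOne n)) ⟩
    Σ⟦ graftOne m ⟧ · ⟦ n ⟧ ⊕ ⟦ m ⟧ · Σ⟦ graftOne n ⟧
      ∎
    where
    graftOne : Mono → List Mono
    graftOne = modifyOne (graftA t)

  ρF-linear : ∀ n z → IsLinear (ρF n z)
  ρF-linear n       (gen t)  = ρgen-linear t
  ρF-linear n       𝟘ᴸ       = zero-linear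
  ρF-linear n       (x ⊕ᴸ y) = ⊕-linear (ρF-linear n x) (ρF-linear n y)
  ρF-linear n       (a ⊙ᴸ x) = ⊙-linear a (ρF-linear n x)
  ρF-linear zero    (br x y) = zero-linear
  ρF-linear (suc n) (br x y) =
    ⊕-linear (⊕-linear (⊕-linear (∘-linear Lx Ly) (⊙-linear -1# (ρF-linear n (x ▷ y))))
                       (⊙-linear -1# (∘-linear Ly Lx)))
             (ρF-linear n (y ▷ x))
    where
    Lx : IsLinear (ρF n x)
    Lx = ρF-linear n x
    Ly : IsLinear (ρF n y)
    Ly = ρF-linear n y

  ρF-derivation : ∀ n z → IsDerivation (ρF n z)
  ρF-derivation n       (gen t)  = ρgen-derivation t
  ρF-derivation n       𝟘ᴸ       = zero-derivation
  ρF-derivation n       (x ⊕ᴸ y) = ⊕-derivation (ρF-derivation n x) (ρF-derivation n y)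
  ρF-derivation n       (a ⊙ᴸ x) = ⊙-derivation a (ρF-derivation n x)
  ρF-derivation zero    (br x y) = zero-derivation
  -- ρ[x,y] = (ρx ρy - ρ(x ▷ y)) - ρy ρx + ρ(y ▷ x), regrouped around the commutator.
  ρF-derivation (suc n) (br x y) =
    derivation-resp (λ α → ∙-congʳ (xy∙z≈xz∙y _ _ _))
      (⊕-derivation (⊕-derivation (commutator-derivation (ρF-linear n x) (ρF-linear n y)
                                                          (ρF-derivation n x) (ρF-derivation n y))
                                  (⊙-derivation -1# (ρF-derivation n (x ▷ y))))
                    (ρF-derivation n (y ▷ x)))

mainTheorem1 : {c ℓ : Level} (F : Field c ℓ) → let open Over F in
    (t : LieE) (α₁ α₂ : SPA) → ρ t (α₁ · α₂) ≋ ρ t α₁ · α₂ ⊕ α₁ · ρ t α₂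
-- The Leibniz rule holds for every fuel, so no bound on the fuel is needed.
mainTheorem1 F t α₁ α₂ = ∼⇒≋ (ρF-derivation (Over.depth F t) t α₁ α₂)
  where open Leibniz F
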